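{- Let $a,b,c,d\in\mathbb{N}$ and let $R=\{(u,v)\in\mathbb{Z}^2: a\le u\le a+b,\ c\le v\le c+d\}$ be the rectangle with vertices $(a,c),(a+b,c),(a,c+d),(a+b,c+d)$. For $(x,y)\in\mathbb{N}^2$ define $$\Gamma(a,b,c,d)(x,y)=\big|\{(u,v)\in R: (x,y)\leadsto(u,v)\}\big|.$$ Suppose $x\ge y$. Then $$\Gamma(a,b,c,d)(x,y)=\begin{cases}\sigma_{b+1,d+1}(x+y-a-c), & 0\le y\le c,\\ \sigma_{b+1,y-c+1}(x-a)+\sigma_{b+1,c+d-y+1}(x-a)-\delta, & c<y<c+d,\\ \sigma_{b+1,d+1}(x-y+c+d-a), & c+d\le y,\end{cases}$$ where $\delta=0$ if $x<a$; $\delta=\lceil\frac{x-a+1}{2}\rceil$ if $a\le x\le a+b$; and if $x>a+b$, then $\delta=\lceil\frac{b+1}{2}\rceil$ when $x-a-b$ is even and $\delta=\lfloor\frac{b+1}{2}\rfloor$ otherwise.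
   Context: Reachability: $(x,y)\leadsto(u,v)$ means $(u,v)$ is obtained from $(x,y)$ by a finite number (possibly zero) of steps of the form $(p,q)\mapsto(p-1,q+1)$ or $(p,q)\mapsto(p-1,q-1)$; equivalently $u\le x$, $|v-y|\le x-u$ and $(x-u)-(v-y)$ is even. For positive integers $k,l$ and any integer $h$, $\sigma_{k,l}(h)$ denotes the number of integer pairs $(r,c)$ with $0\le r\le l-1$, $0\le c\le k-1$, $r+c\le h$ and $r+c\equiv h\pmod 2$ (so $\sigma_{k,l}(h)=0$ for $h<0$). -}

module Defs where

open import Data.Bool using (Bool; true; false; _∧_; if_then_else_)
open import Data.Nat using (ℕ; zero; suc; _%_; _/_) renaming (_+_ to _+ℕ_; _∸_ to _∸ℕ_; _≤ᵇ_ to _≤ᵇℕ_; _<ᵇ_ to _<ᵇℕ_; _≡ᵇ_ to _≡ᵇℕ_)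
open import Data.Integer using (ℤ; +_; _+_; _-_; ∣_∣; _≤?_)
open import Data.List using (List; []; _∷_; upTo; map; cartesianProduct)
open import Data.Product using (_×_; _,_)
open import Relation.Nullary using (does)

count : {A : Set} → (A → Bool) → List A → ℕ
count p [] = 0
count p (x ∷ xs) = if p x then suc (count p xs) else count p xs

evenᵇ : ℤ → Bool
evenᵇ z = (∣ z ∣ % 2) ≡ᵇℕ 0

σ : ℕ → ℕ → ℤ → ℕ
σ k l h = count (λ { (r , c) → does ((+ (r +ℕ c)) ≤? h) ∧ evenᵇ (h - + (r +ℕ c)) })
                (cartesianProduct (upTo l) (upTo k))

reachᵇ : ℤ → ℤ → ℤ → ℤ → Bool
reachᵇ x y u v = does (u ≤? x) ∧ does (+ ∣ v - y ∣ ≤? (x - u)) ∧ evenᵇ ((x - u) - (v - y))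

Γ : ℕ → ℕ → ℕ → ℕ → ℕ → ℕ → ℕ
Γ a b c d x y = count (λ { (i , j) → reachᵇ (+ x) (+ y) (+ (a +ℕ i)) (+ (c +ℕ j)) })
                      (cartesianProduct (upTo (suc b)) (upTo (suc d)))

-- δ from the statement (ℕ-division is floor; ⌈m/2⌉ = (m+1)/2)
δ : ℕ → ℕ → ℕ → ℕ
δ a b x =
  if x <ᵇℕ a then 0
  else if x ≤ᵇℕ (a +ℕ b) then ((x ∸ℕ a) +ℕ 2) / 2
  else if ((x ∸ℕ (a +ℕ b)) % 2) ≡ᵇℕ 0 then (b +ℕ 2) / 2
  else (b +ℕ 1) / 2

{-# OPTIONS --safe #-}
module Submission where

-- A lattice point (u, v) is reachable from (x, y) exactly when (x − u) − |v − y| is even and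
-- nonnegative. On the rows v ≥ y of the rectangle this quantity at (a + i, c + j) is
-- (x + y − a − c) − (j + i), so Γ is σ_{b+1,d+1}(x + y − a − c); on the rows v ≤ y it is
-- (x − y + c + d − a) − ((d − j) + i), and reading the rows backwards gives σ again. A rectangle
-- straddling row y is cut along that row into one rectangle of each kind; row y is then counted
-- twice, and its count σ_{b+1,1}(x − a) is the parity count tabulated by δ.

open import Defs
open import Algebra.Properties.CommutativeSemigroup using (interchange)
open import Data.Bool using (Bool; true; false; not; _∧_; if_then_else_)
open import Data.Bool.Properties using (∧-assoc)
open import Data.Integer using (ℤ; +_; -_; _+_; _-_; ∣_∣; 0ℤ; +≤+; _≤?_) renaming (_≤_ to _≤ℤ_; _<_ to _<ℤ_)
open import Data.Integer.Divisibility.Signed using (_∣_; divides; _∣?_; ∣m∣n⇒∣m+n; ∣m∣n⇒∣m-n)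
import Data.Integer.Properties as ℤ
open import Data.Integer.Tactic.RingSolver using (solve-∀)
open import Data.List using (List; []; _∷_; _++_; map; applyUpTo; upTo; cartesianProduct)
open import Data.Nat using (ℕ; zero; suc; _≤_; _<_; _∸_; _/_; z≤n; s≤s) renaming (_+_ to _+ℕ_)
open import Data.Nat.DivMod using (m/n≡1+[m∸n]/n)
import Data.Nat.Properties as ℕ
open import Data.Product using (_×_; _,_)
open import Data.Sum using (inj₁; inj₂)
open import Function using (_∘_; mk⇔)
open import Relation.Binary.PropositionalEquality using (_≡_; refl; sym; trans; cong; cong₂; subst; module ≡-Reasoning)
open import Relation.Nullary using (Dec; yes; no; does; ¬_; contradiction)
open import Relation.Nullary.Decidable using (dec-true; dec-false; does-⇔)

open ≡-Reasoning

indicator : Bool → ℕ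
indicator true  = 1
indicator false = 0

∑ : ℕ → (ℕ → ℕ) → ℕ
∑ zero    f = 0
∑ (suc n) f = f 0 +ℕ ∑ n (f ∘ suc)

∑-cong : ∀ n {f g : ℕ → ℕ} → (∀ {i} → i < n → f i ≡ g i) → ∑ n f ≡ ∑ n g
∑-cong zero    _   = refl
∑-cong (suc n) f≡g = cong₂ _+ℕ_ (f≡g (s≤s z≤n)) (∑-cong n (f≡g ∘ s≤s))

∑-zero : ∀ n {f : ℕ → ℕ} → (∀ i → f i ≡ 0) → ∑ n f ≡ 0
∑-zero zero    _   = refl
∑-zero (suc n) f≡0 = cong₂ _+ℕ_ (f≡0 0) (∑-zero n (f≡0 ∘ suc))

∑-distrib-+ : ∀ n (f g : ℕ → ℕ) → ∑ n (λ i → f i +ℕ g i) ≡ ∑ n f +ℕ ∑ n g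
∑-distrib-+ zero    f g = refl
∑-distrib-+ (suc n) f g = begin
  (f 0 +ℕ g 0) +ℕ ∑ n (λ i → f (suc i) +ℕ g (suc i))
    ≡⟨ cong (f 0 +ℕ g 0 +ℕ_) (∑-distrib-+ n (f ∘ suc) (g ∘ suc)) ⟩
  (f 0 +ℕ g 0) +ℕ (∑ n (f ∘ suc) +ℕ ∑ n (g ∘ suc))
    ≡⟨ interchange ℕ.+-commutativeSemigroup (f 0) (g 0) _ _ ⟩
  ∑ (suc n) f +ℕ ∑ (suc n) g
    ∎

∑-comm : ∀ m n (f : ℕ → ℕ → ℕ) → ∑ m (λ i → ∑ n (f i)) ≡ ∑ n (λ j → ∑ m (λ i → f i j))
∑-comm zero    n f = sym (∑-zero n (λ _ → refl))
∑-comm (suc m) n f = begin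
  ∑ n (f 0) +ℕ ∑ m (λ i → ∑ n (f (suc i)))         ≡⟨ cong (∑ n (f 0) +ℕ_) (∑-comm m n (f ∘ suc)) ⟩
  ∑ n (f 0) +ℕ ∑ n (λ j → ∑ m (λ i → f (suc i) j)) ≡⟨ ∑-distrib-+ n (f 0) _ ⟨
  ∑ n (λ j → ∑ (suc m) (λ i → f i j))               ∎

∑-split : ∀ m n (f : ℕ → ℕ) → ∑ (m +ℕ n) f ≡ ∑ m f +ℕ ∑ n (λ i → f (m +ℕ i))
∑-split zero    n f = refl
∑-split (suc m) n f = trans (cong (f 0 +ℕ_) (∑-split m n (f ∘ suc))) (sym (ℕ.+-assoc (f 0) _ _))

∑-snoc : ∀ n (f : ℕ → ℕ) → ∑ (suc n) f ≡ ∑ n f +ℕ f n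
∑-snoc zero    f = ℕ.+-comm (f 0) 0
∑-snoc (suc n) f = trans (cong (f 0 +ℕ_) (∑-snoc n (f ∘ suc))) (sym (ℕ.+-assoc (f 0) _ _))

∑-reverse : ∀ n (f : ℕ → ℕ) → ∑ (suc n) (λ i → f (n ∸ i)) ≡ ∑ (suc n) f
∑-reverse zero    f = refl
∑-reverse (suc n) f = begin
  f (suc n) +ℕ ∑ (suc n) (λ i → f (n ∸ i)) ≡⟨ cong (f (suc n) +ℕ_) (∑-reverse n f) ⟩
  f (suc n) +ℕ ∑ (suc n) f                 ≡⟨ ℕ.+-comm (f (suc n)) _ ⟩
  ∑ (suc n) f +ℕ f (suc n)                 ≡⟨ ∑-snoc (suc n) f ⟨
  ∑ (suc (suc n)) f                        ∎

∑-split-overlapping : ∀ m n (f : ℕ → ℕ) →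
  ∑ (suc (m +ℕ n)) f +ℕ f m ≡ ∑ (suc m) f +ℕ ∑ (suc n) (λ j → f (m +ℕ j))
∑-split-overlapping m n f = begin
  ∑ (suc m +ℕ n) f +ℕ f m                            ≡⟨ cong (_+ℕ f m) (∑-split (suc m) n f) ⟩
  (∑ (suc m) f +ℕ ∑ n (λ j → f (suc m +ℕ j))) +ℕ f m ≡⟨ ℕ.+-assoc (∑ (suc m) f) _ (f m) ⟩
  ∑ (suc m) f +ℕ (∑ n (λ j → f (suc m +ℕ j)) +ℕ f m) ≡⟨ cong (∑ (suc m) f +ℕ_) (ℕ.+-comm _ (f m)) ⟩
  ∑ (suc m) f +ℕ (f m +ℕ ∑ n (λ j → f (suc m +ℕ j))) ≡⟨ cong (∑ (suc m) f +ℕ_) (cong₂ _+ℕ_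
                                                          (cong f (sym (ℕ.+-identityʳ m)))
                                                          (∑-cong n (λ {j} _ → cong f (sym (ℕ.+-suc m j))))) ⟩
  ∑ (suc m) f +ℕ ∑ (suc n) (λ j → f (m +ℕ j))          ∎

count-++ : ∀ {A : Set} (p : A → Bool) (xs ys : List A) → count p (xs ++ ys) ≡ count p xs +ℕ count p ys
count-++ p []       ys = refl
count-++ p (x ∷ xs) ys with p x
... | true  = cong suc (count-++ p xs ys)
... | false = count-++ p xs ys

count-map : ∀ {A B : Set} (p : B → Bool) (f : A → B) (xs : List A) → count p (map f xs) ≡ count (p ∘ f) xs
count-map p f []       = refl
count-map p f (x ∷ xs) with p (f x)
... | true  = cong suc (count-map p f xs)
... | false = count-map p f xs

count-applyUpTo : ∀ {A : Set} (p : A → Bool) (f : ℕ → A) n →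
  count p (applyUpTo f n) ≡ ∑ n (λ i → indicator (p (f i)))
count-applyUpTo p f zero    = refl
count-applyUpTo p f (suc n) with p (f 0)
... | true  = cong suc (count-applyUpTo p (f ∘ suc) n)
... | false = count-applyUpTo p (f ∘ suc) n

count-cartesianProduct : ∀ {A B : Set} (p : A × B → Bool) (f : ℕ → A) m (ys : List B) →
  count p (cartesianProduct (applyUpTo f m) ys) ≡ ∑ m (λ i → count (λ y → p (f i , y)) ys)
count-cartesianProduct p f zero    ys = refl
count-cartesianProduct p f (suc m) ys = begin
  count p (map (f 0 ,_) ys ++ cartesianProduct (applyUpTo (f ∘ suc) m) ys)
    ≡⟨ count-++ p (map (f 0 ,_) ys) _ ⟩
  count p (map (f 0 ,_) ys) +ℕ count p (cartesianProduct (applyUpTo (f ∘ suc) m) ys)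
    ≡⟨ cong₂ _+ℕ_ (count-map p (f 0 ,_) ys) (count-cartesianProduct p (f ∘ suc) m ys) ⟩
  ∑ (suc m) (λ i → count (λ y → p (f i , y)) ys)
    ∎

count-upTo×upTo : ∀ (p : ℕ × ℕ → Bool) m n →
  count p (cartesianProduct (upTo m) (upTo n)) ≡ ∑ m (λ i → ∑ n (λ j → indicator (p (i , j))))
count-upTo×upTo p m n =
  trans (count-cartesianProduct p (λ i → i) m (upTo n))
        (∑-cong m (λ {i} _ → count-applyUpTo (λ j → p (i , j)) (λ j → j) n))

does-∧-implied : ∀ {A B : Set} → (B → A) → (a? : Dec A) (b? : Dec B) → does a? ∧ does b? ≡ does b?
does-∧-implied _   (yes _) _       = refl
does-∧-implied B⇒A (no ¬a) (yes b) = contradiction (B⇒A b) ¬a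
does-∧-implied _   (no _)  (no _)  = refl

does[i≤?j]≡does[0≤?j-i] : ∀ i j → does (i ≤? j) ≡ does (0ℤ ≤? j - i)
does[i≤?j]≡does[0≤?j-i] i j = does-⇔ (mk⇔ ℤ.i≤j⇒0≤j-i ℤ.0≤i-j⇒j≤i) (i ≤? j) (0ℤ ≤? j - i)

0≰+m-+n : ∀ {m n} → m < n → ¬ (0ℤ ≤ℤ + m - + n)
0≰+m-+n m<n 0≤m-n = ℕ.<⇒≱ m<n (ℤ.drop‿+≤+ (ℤ.0≤i-j⇒j≤i 0≤m-n))

pos-∸ : ∀ {m n} → n ≤ m → + (m ∸ n) ≡ + m - + n
pos-∸ {m} {n} n≤m = sym (trans (ℤ.m-n≡m⊖n m n) (ℤ.⊖-≥ n≤m))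

m+n≡o+p⇒+m≡[+o++p]-+n : ∀ m n o p → m +ℕ n ≡ o +ℕ p → + m ≡ (+ o + + p) - + n
m+n≡o+p⇒+m≡[+o++p]-+n m n o p m+n≡o+p = begin
  + m                  ≡⟨ cancel (+ m) (+ n) ⟨
  (+ m + + n) - + n    ≡⟨ cong (λ u → u - + n) (ℤ.pos-+ m n) ⟨
  + (m +ℕ n) - + n     ≡⟨ cong (λ k → + k - + n) m+n≡o+p ⟩
  + (o +ℕ p) - + n     ≡⟨ cong (λ u → u - + n) (ℤ.pos-+ o p) ⟩
  (+ o + + p) - + n    ∎
  where
  cancel : ∀ M N → (M + N) - N ≡ M
  cancel = solve-∀

evenᵇ-suc : ∀ n → evenᵇ (+ suc n) ≡ not (evenᵇ (+ n))
evenᵇ-suc zero          = refl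
evenᵇ-suc (suc zero)    = refl
evenᵇ-suc (suc (suc n)) = evenᵇ-suc n

∑-evenᵇ : ∀ n t → ∑ n (λ c → indicator (evenᵇ (+ (c +ℕ t)))) ≡ (indicator (evenᵇ (+ t)) +ℕ n) / 2
∑-evenᵇ zero t with evenᵇ (+ t)
... | true  = refl
... | false = refl
∑-evenᵇ (suc n) t = begin
  indicator (evenᵇ (+ t)) +ℕ ∑ n (λ c → indicator (evenᵇ (+ suc (c +ℕ t))))
    ≡⟨ cong (indicator (evenᵇ (+ t)) +ℕ_)
            (∑-cong n (λ {c} _ → cong (λ k → indicator (evenᵇ (+ k))) (sym (ℕ.+-suc c t)))) ⟩
  indicator (evenᵇ (+ t)) +ℕ ∑ n (λ c → indicator (evenᵇ (+ (c +ℕ suc t))))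
    ≡⟨ cong (indicator (evenᵇ (+ t)) +ℕ_) (∑-evenᵇ n (suc t)) ⟩
  indicator (evenᵇ (+ t)) +ℕ (indicator (evenᵇ (+ suc t)) +ℕ n) / 2
    ≡⟨ cong (λ e → indicator (evenᵇ (+ t)) +ℕ (indicator e +ℕ n) / 2) (evenᵇ-suc t) ⟩
  indicator (evenᵇ (+ t)) +ℕ (indicator (not (evenᵇ (+ t))) +ℕ n) / 2
    ≡⟨ step (evenᵇ (+ t)) ⟩
  (indicator (evenᵇ (+ t)) +ℕ suc n) / 2
    ∎
  where
  step : ∀ e → indicator e +ℕ (indicator (not e) +ℕ n) / 2 ≡ (indicator e +ℕ suc n) / 2
  step true  = sym (m/n≡1+[m∸n]/n {suc (suc n)} {2} (s≤s (s≤s z≤n)))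
  step false = refl

-- evenᵇ z computes to does (+ 2 ∣? z).
evenᵇ[i+j]≡evenᵇ[i-j] : ∀ i j → evenᵇ (i + j) ≡ evenᵇ (i - j)
evenᵇ[i+j]≡evenᵇ[i-j] i j = does-⇔ (mk⇔ to from) (+ 2 ∣? i + j) (+ 2 ∣? i - j)
  where
  2∣j+j : + 2 ∣ j + j
  2∣j+j = divides j (sym (trans (ℤ.*-distribˡ-+ j (+ 1) (+ 1)) (cong₂ _+_ (ℤ.*-identityʳ j) (ℤ.*-identityʳ j))))
  sub : ∀ i j → (i + j) - (j + j) ≡ i - j
  sub = solve-∀
  add : ∀ i j → (i - j) + (j + j) ≡ i + j
  add = solve-∀
  to : + 2 ∣ i + j → + 2 ∣ i - j
  to 2∣i+j = subst (+ 2 ∣_) (sub i j) (∣m∣n⇒∣m-n 2∣i+j 2∣j+j)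
  from : + 2 ∣ i - j → + 2 ∣ i + j
  from 2∣i-j = subst (+ 2 ∣_) (add i j) (∣m∣n⇒∣m+n 2∣i-j 2∣j+j)

evenᵇ[i-∣j∣]≡evenᵇ[i-j] : ∀ i j → evenᵇ (i - + ∣ j ∣) ≡ evenᵇ (i - j)
evenᵇ[i-∣j∣]≡evenᵇ[i-j] i j with ℤ.+∣i∣≡i⊎+∣i∣≡-i j
... | inj₁ ∣j∣≡j  = cong (λ k → evenᵇ (i - k)) ∣j∣≡j
... | inj₂ ∣j∣≡-j = begin
  evenᵇ (i - + ∣ j ∣) ≡⟨ cong (λ k → evenᵇ (i - k)) ∣j∣≡-j ⟩
  evenᵇ (i - - j)     ≡⟨ cong (λ k → evenᵇ (i + k)) (ℤ.neg-involutive j) ⟩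
  evenᵇ (i + j)       ≡⟨ evenᵇ[i+j]≡evenᵇ[i-j] i j ⟩
  evenᵇ (i - j)       ∎

nonnegEvenᵇ : ℤ → Bool
nonnegEvenᵇ z = does (0ℤ ≤? z) ∧ evenᵇ z

nonnegEvenᵇ-false : ∀ {z} → ¬ (0ℤ ≤ℤ z) → nonnegEvenᵇ z ≡ false
nonnegEvenᵇ-false {z} 0≰z = cong (_∧ evenᵇ z) (dec-false (0ℤ ≤? z) 0≰z)

reachᵇ≡nonnegEvenᵇ : ∀ X Y U V → reachᵇ X Y U V ≡ nonnegEvenᵇ ((X - U) - + ∣ V - Y ∣)
reachᵇ≡nonnegEvenᵇ X Y U V = begin
  does (U ≤? X) ∧ does (+ ∣ V - Y ∣ ≤? X - U) ∧ evenᵇ ((X - U) - (V - Y))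
    ≡⟨ ∧-assoc (does (U ≤? X)) _ _ ⟨
  (does (U ≤? X) ∧ does (+ ∣ V - Y ∣ ≤? X - U)) ∧ evenᵇ ((X - U) - (V - Y))
    ≡⟨ cong₂ _∧_ (trans (does-∧-implied below (U ≤? X) (+ ∣ V - Y ∣ ≤? X - U))
                        (does[i≤?j]≡does[0≤?j-i] (+ ∣ V - Y ∣) (X - U)))
                 (sym (evenᵇ[i-∣j∣]≡evenᵇ[i-j] (X - U) (V - Y))) ⟩
  nonnegEvenᵇ ((X - U) - + ∣ V - Y ∣)
    ∎
  where
  below : + ∣ V - Y ∣ ≤ℤ X - U → U ≤ℤ X
  below ∣V-Y∣≤X-U = ℤ.0≤i-j⇒j≤i (ℤ.≤-trans (+≤+ z≤n) ∣V-Y∣≤X-U)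

reachᵇ-above : ∀ X Y U V → Y ≤ℤ V → reachᵇ X Y U V ≡ nonnegEvenᵇ ((X + Y) - (U + V))
reachᵇ-above X Y U V Y≤V = trans (reachᵇ≡nonnegEvenᵇ X Y U V) (cong nonnegEvenᵇ (begin
  (X - U) - + ∣ V - Y ∣ ≡⟨ cong (λ k → (X - U) - k) (ℤ.0≤i⇒+∣i∣≡i (ℤ.i≤j⇒0≤j-i Y≤V)) ⟩
  (X - U) - (V - Y)     ≡⟨ regroup X Y U V ⟩
  (X + Y) - (U + V)     ∎))
  where
  regroup : ∀ X Y U V → (X - U) - (V - Y) ≡ (X + Y) - (U + V)
  regroup = solve-∀

reachᵇ-below : ∀ X Y U V → V ≤ℤ Y → reachᵇ X Y U V ≡ nonnegEvenᵇ ((X - Y) - (U - V))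
reachᵇ-below X Y U V V≤Y = trans (reachᵇ≡nonnegEvenᵇ X Y U V) (cong nonnegEvenᵇ (begin
  (X - U) - + ∣ V - Y ∣ ≡⟨ cong (λ k → (X - U) - + k) (ℤ.∣i-j∣≡∣j-i∣ V Y) ⟩
  (X - U) - + ∣ Y - V ∣ ≡⟨ cong (λ k → (X - U) - k) (ℤ.0≤i⇒+∣i∣≡i (ℤ.i≤j⇒0≤j-i V≤Y)) ⟩
  (X - U) - (Y - V)     ≡⟨ regroup X Y U V ⟩
  (X - Y) - (U - V)     ∎))
  where
  regroup : ∀ X Y U V → (X - U) - (Y - V) ≡ (X - Y) - (U - V)
  regroup = solve-∀

σ≡∑∑ : ∀ k l h → σ k l h ≡ ∑ l (λ r → ∑ k (λ c → indicator (nonnegEvenᵇ (h - + (r +ℕ c)))))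
σ≡∑∑ k l h = trans (count-upTo×upTo _ l k) (∑-cong l (λ {r} _ → ∑-cong k (λ {c} _ →
  cong (λ t → indicator (t ∧ evenᵇ (h - + (r +ℕ c)))) (does[i≤?j]≡does[0≤?j-i] (+ (r +ℕ c)) h))))

Γ≡∑∑ : ∀ a b c d x y →
  Γ a b c d x y ≡ ∑ (suc d) (λ j → ∑ (suc b) (λ i → indicator (reachᵇ (+ x) (+ y) (+ (a +ℕ i)) (+ (c +ℕ j)))))
Γ≡∑∑ a b c d x y = trans (count-upTo×upTo _ (suc b) (suc d)) (∑-comm (suc b) (suc d)
  (λ i j → indicator (reachᵇ (+ x) (+ y) (+ (a +ℕ i)) (+ (c +ℕ j)))))

σ-negative : ∀ k l {h} → h <ℤ 0ℤ → σ k l h ≡ 0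
σ-negative k l {h} h<0 = trans (σ≡∑∑ k l h)
  (∑-zero l (λ r → ∑-zero k (λ c → cong indicator (nonnegEvenᵇ-false (h-s≱0 (r +ℕ c))))))
  where
  h-s≱0 : ∀ s → ¬ (0ℤ ≤ℤ h - + s)
  h-s≱0 s 0≤h-s = ℤ.<⇒≱ h<0 (ℤ.≤-trans (+≤+ z≤n) (ℤ.0≤i-j⇒j≤i 0≤h-s))

σ-row : ∀ k h → σ k 1 h ≡ ∑ k (λ c → indicator (nonnegEvenᵇ (h - + c)))
σ-row k h = trans (σ≡∑∑ k 1 h) (ℕ.+-identityʳ _)

-- The third step uses that nonnegEvenᵇ (+ k) computes to evenᵇ (+ k).
σ-row-parity : ∀ n t → σ (suc n) 1 (+ (n +ℕ t)) ≡ (indicator (evenᵇ (+ t)) +ℕ suc n) / 2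
σ-row-parity n t = begin
  σ (suc n) 1 (+ (n +ℕ t))                          ≡⟨ σ-row (suc n) (+ (n +ℕ t)) ⟩
  ∑ (suc n) row                                     ≡⟨ ∑-reverse n row ⟨
  ∑ (suc n) (λ c → row (n ∸ c))                     ≡⟨ ∑-cong (suc n) (λ c<1+n → cong (indicator ∘ nonnegEvenᵇ) (reflect c<1+n)) ⟩
  ∑ (suc n) (λ c → indicator (evenᵇ (+ (c +ℕ t))))  ≡⟨ ∑-evenᵇ (suc n) t ⟩
  (indicator (evenᵇ (+ t)) +ℕ suc n) / 2            ∎
  where
  row : ℕ → ℕ
  row c = indicator (nonnegEvenᵇ (+ (n +ℕ t) - + c))
  regroup : ∀ N T C → (N + T) - (N - C) ≡ C + T
  regroup = solve-∀
  reflect : ∀ {c} → c < suc n → + (n +ℕ t) - + (n ∸ c) ≡ + (c +ℕ t)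
  reflect {c} c<1+n = begin
    + (n +ℕ t) - + (n ∸ c)    ≡⟨ cong₂ _-_ (ℤ.pos-+ n t) (pos-∸ (ℕ.≤-pred c<1+n)) ⟩
    (+ n + + t) - (+ n - + c) ≡⟨ regroup (+ n) (+ t) (+ c) ⟩
    + c + + t                 ≡⟨ ℤ.pos-+ c t ⟨
    + (c +ℕ t)                ∎

σ-row-truncate : ∀ m e → σ (suc (m +ℕ e)) 1 (+ m) ≡ σ (suc m) 1 (+ m)
σ-row-truncate m e = begin
  σ (suc m +ℕ e) 1 (+ m)                                        ≡⟨ σ-row (suc m +ℕ e) (+ m) ⟩
  ∑ (suc m +ℕ e) row                                            ≡⟨ ∑-split (suc m) e row ⟩
  ∑ (suc m) row +ℕ ∑ e (λ i → row (suc m +ℕ i))                 ≡⟨ cong (∑ (suc m) row +ℕ_) (∑-zero e beyond) ⟩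
  ∑ (suc m) row +ℕ 0                                            ≡⟨ ℕ.+-identityʳ _ ⟩
  ∑ (suc m) row                                                 ≡⟨ σ-row (suc m) (+ m) ⟨
  σ (suc m) 1 (+ m)                                             ∎
  where
  row : ℕ → ℕ
  row c = indicator (nonnegEvenᵇ (+ m - + c))
  beyond : ∀ i → row (suc m +ℕ i) ≡ 0
  beyond i = cong indicator (nonnegEvenᵇ-false (0≰+m-+n (ℕ.m≤m+n (suc m) i)))

δ-below : ∀ {a} b {x} → x < a → δ a b x ≡ 0
δ-below {a} b {x} x<a rewrite dec-true (x ℕ.<? a) x<a = refl

δ-shift : ∀ a b m → δ a b (a +ℕ m) ≡ δ 0 b m
δ-shift a b m
  rewrite dec-false (a +ℕ m ℕ.<? a) (ℕ.m+n≮m a m)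
        | does-⇔ (mk⇔ (ℕ.+-cancelˡ-≤ a m b) (ℕ.+-monoʳ-≤ a)) (a +ℕ m ℕ.≤? a +ℕ b) (m ℕ.≤? b)
        | ℕ.m+n∸m≡n a m
        | ℕ.[m+n]∸[m+o]≡n∸o a m b
        = refl

δ₀≡σ-row : ∀ b m → δ 0 b m ≡ σ (suc b) 1 (+ m)
δ₀≡σ-row b m with m ℕ.≤? b
... | yes m≤b rewrite dec-true (m ℕ.≤? b) m≤b with ℕ.m≤n⇒∃[o]m+o≡n m≤b
...   | e , refl = begin
  (m +ℕ 2) / 2                 ≡⟨ cong (_/ 2) (ℕ.+-comm m 2) ⟩
  suc (suc m) / 2              ≡⟨ σ-row-parity m 0 ⟨
  σ (suc m) 1 (+ (m +ℕ 0))     ≡⟨ cong (σ (suc m) 1 ∘ +_) (ℕ.+-identityʳ m) ⟩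
  σ (suc m) 1 (+ m)            ≡⟨ σ-row-truncate m e ⟨
  σ (suc (m +ℕ e)) 1 (+ m)     ∎
δ₀≡σ-row b m | no m≰b rewrite dec-false (m ℕ.≤? b) m≰b with ℕ.m≤n⇒∃[o]m+o≡n (ℕ.≰⇒≥ m≰b)
...   | t , refl rewrite ℕ.m+n∸m≡n b t = trans (halve (evenᵇ (+ t))) (sym (σ-row-parity b t))
  where
  halve : ∀ e → (if e then (b +ℕ 2) / 2 else (b +ℕ 1) / 2) ≡ (indicator e +ℕ suc b) / 2
  halve true  = cong (_/ 2) (ℕ.+-comm b 2)
  halve false = cong (_/ 2) (ℕ.+-comm b 1)

δ≡σ-row : ∀ a b x → δ a b x ≡ σ (b +ℕ 1) 1 (+ x - + a)
δ≡σ-row a b x with x ℕ.<? a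
... | yes x<a = trans (δ-below b x<a) (sym (σ-negative (b +ℕ 1) 1 (ℤ.≰⇒> (0≰+m-+n x<a))))
... | no  x≮a with ℕ.m≤n⇒∃[o]m+o≡n (ℕ.≮⇒≥ x≮a)
...   | m , refl = begin
  δ a b (a +ℕ m)                   ≡⟨ δ-shift a b m ⟩
  δ 0 b m                          ≡⟨ δ₀≡σ-row b m ⟩
  σ (suc b) 1 (+ m)                ≡⟨ cong₂ (λ k h → σ k 1 h) (ℕ.+-comm 1 b) +m≡+[a+m]-+a ⟩
  σ (b +ℕ 1) 1 (+ (a +ℕ m) - + a)  ∎
  where
  +m≡+[a+m]-+a : + m ≡ + (a +ℕ m) - + a
  +m≡+[a+m]-+a = trans (cong +_ (sym (ℕ.m+n∸m≡n a m))) (pos-∸ (ℕ.m≤m+n a m))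

Γ-above : ∀ a b c d x y → y ≤ c → Γ a b c d x y ≡ σ (b +ℕ 1) (d +ℕ 1) (((+ x) + (+ y)) - (+ a) - (+ c))
Γ-above a b c d x y y≤c = begin
  Γ a b c d x y
    ≡⟨ Γ≡∑∑ a b c d x y ⟩
  ∑ (suc d) (λ j → ∑ (suc b) (λ i → indicator (reachᵇ (+ x) (+ y) (+ (a +ℕ i)) (+ (c +ℕ j)))))
    ≡⟨ ∑-cong (suc d) (λ {j} _ → ∑-cong (suc b) (λ {i} _ → cong indicator (trans
         (reachᵇ-above (+ x) (+ y) (+ (a +ℕ i)) (+ (c +ℕ j)) (+≤+ (ℕ.≤-trans y≤c (ℕ.m≤m+n c j))))
         (cong nonnegEvenᵇ (height i j))))) ⟩
  ∑ (suc d) (λ j → ∑ (suc b) (λ i → indicator (nonnegEvenᵇ (h - + (j +ℕ i)))))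
    ≡⟨ σ≡∑∑ (suc b) (suc d) h ⟨
  σ (suc b) (suc d) h
    ≡⟨ cong₂ (λ k l → σ k l h) (ℕ.+-comm 1 b) (ℕ.+-comm 1 d) ⟩
  σ (b +ℕ 1) (d +ℕ 1) h
    ∎
  where
  h : ℤ
  h = ((+ x) + (+ y)) - (+ a) - (+ c)
  regroup : ∀ X Y A C I J → (X + Y) - ((A + I) + (C + J)) ≡ ((X + Y) - A - C) - (J + I)
  regroup = solve-∀
  height : ∀ i j → (+ x + + y) - (+ (a +ℕ i) + + (c +ℕ j)) ≡ h - + (j +ℕ i)
  height i j = begin
    (+ x + + y) - (+ (a +ℕ i) + + (c +ℕ j))     ≡⟨ cong₂ (λ u v → (+ x + + y) - (u + v)) (ℤ.pos-+ a i) (ℤ.pos-+ c j) ⟩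
    (+ x + + y) - ((+ a + + i) + (+ c + + j))   ≡⟨ regroup (+ x) (+ y) (+ a) (+ c) (+ i) (+ j) ⟩
    h - (+ j + + i)                             ≡⟨ cong (λ u → h - u) (ℤ.pos-+ j i) ⟨
    h - + (j +ℕ i)                              ∎

Γ-below : ∀ a b c d x y → c +ℕ d ≤ y →
  Γ a b c d x y ≡ σ (b +ℕ 1) (d +ℕ 1) ((+ x) - (+ y) + (+ c) + (+ d) - (+ a))
Γ-below a b c d x y c+d≤y = begin
  Γ a b c d x y
    ≡⟨ Γ≡∑∑ a b c d x y ⟩
  ∑ (suc d) (λ j → ∑ (suc b) (λ i → indicator (reachᵇ (+ x) (+ y) (+ (a +ℕ i)) (+ (c +ℕ j)))))
    ≡⟨ ∑-cong (suc d) (λ {j} j<1+d → ∑-cong (suc b) (λ {i} _ → cong indicator (trans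
         (reachᵇ-below (+ x) (+ y) (+ (a +ℕ i)) (+ (c +ℕ j))
           (+≤+ (ℕ.≤-trans (ℕ.+-monoʳ-≤ c (ℕ.≤-pred j<1+d)) c+d≤y)))
         (cong nonnegEvenᵇ (depth i (ℕ.≤-pred j<1+d)))))) ⟩
  ∑ (suc d) (λ j → row (d ∸ j))
    ≡⟨ ∑-reverse d row ⟩
  ∑ (suc d) row
    ≡⟨ σ≡∑∑ (suc b) (suc d) h ⟨
  σ (suc b) (suc d) h
    ≡⟨ cong₂ (λ k l → σ k l h) (ℕ.+-comm 1 b) (ℕ.+-comm 1 d) ⟩
  σ (b +ℕ 1) (d +ℕ 1) h
    ∎
  where
  h : ℤ
  h = (+ x) - (+ y) + (+ c) + (+ d) - (+ a)
  row : ℕ → ℕ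
  row r = ∑ (suc b) (λ i → indicator (nonnegEvenᵇ (h - + (r +ℕ i))))
  regroup : ∀ X Y A C D I J → (X - Y) - ((A + I) - (C + J)) ≡ (X - Y + C + D - A) - ((D - J) + I)
  regroup = solve-∀
  depth : ∀ i {j} → j ≤ d → (+ x - + y) - (+ (a +ℕ i) - + (c +ℕ j)) ≡ h - + ((d ∸ j) +ℕ i)
  depth i {j} j≤d = begin
    (+ x - + y) - (+ (a +ℕ i) - + (c +ℕ j))     ≡⟨ cong₂ (λ u v → (+ x - + y) - (u - v)) (ℤ.pos-+ a i) (ℤ.pos-+ c j) ⟩
    (+ x - + y) - ((+ a + + i) - (+ c + + j))   ≡⟨ regroup (+ x) (+ y) (+ a) (+ c) (+ d) (+ i) (+ j) ⟩
    h - ((+ d - + j) + + i)                     ≡⟨ cong (λ u → h - (u + + i)) (pos-∸ j≤d) ⟨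
    h - (+ (d ∸ j) + + i)                       ≡⟨ cong (λ u → h - u) (ℤ.pos-+ (d ∸ j) i) ⟨
    h - + ((d ∸ j) +ℕ i)                        ∎

Γ-split : ∀ a b c d₁ d₂ x y →
  Γ a b c (d₁ +ℕ d₂) x y +ℕ Γ a b (c +ℕ d₁) 0 x y ≡ Γ a b c d₁ x y +ℕ Γ a b (c +ℕ d₁) d₂ x y
Γ-split a b c d₁ d₂ x y = begin
  Γ a b c (d₁ +ℕ d₂) x y +ℕ Γ a b (c +ℕ d₁) 0 x y
    ≡⟨ cong₂ _+ℕ_ (Γ≡∑∑ a b c (d₁ +ℕ d₂) x y) (Γ≡∑∑ a b (c +ℕ d₁) 0 x y) ⟩
  ∑ (suc (d₁ +ℕ d₂)) (column ∘ (c +ℕ_)) +ℕ (column ((c +ℕ d₁) +ℕ 0) +ℕ 0)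
    ≡⟨ cong (∑ (suc (d₁ +ℕ d₂)) (column ∘ (c +ℕ_)) +ℕ_)
            (trans (ℕ.+-identityʳ _) (cong column (ℕ.+-identityʳ (c +ℕ d₁)))) ⟩
  ∑ (suc (d₁ +ℕ d₂)) (column ∘ (c +ℕ_)) +ℕ column (c +ℕ d₁)
    ≡⟨ ∑-split-overlapping d₁ d₂ (column ∘ (c +ℕ_)) ⟩
  ∑ (suc d₁) (column ∘ (c +ℕ_)) +ℕ ∑ (suc d₂) (λ j → column (c +ℕ (d₁ +ℕ j)))
    ≡⟨ cong (∑ (suc d₁) (column ∘ (c +ℕ_)) +ℕ_)
            (∑-cong (suc d₂) (λ {j} _ → cong column (sym (ℕ.+-assoc c d₁ j)))) ⟩
  ∑ (suc d₁) (column ∘ (c +ℕ_)) +ℕ ∑ (suc d₂) (λ j → column ((c +ℕ d₁) +ℕ j))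
    ≡⟨ cong₂ _+ℕ_ (Γ≡∑∑ a b c d₁ x y) (Γ≡∑∑ a b (c +ℕ d₁) d₂ x y) ⟨
  Γ a b c d₁ x y +ℕ Γ a b (c +ℕ d₁) d₂ x y
    ∎
  where
  column : ℕ → ℕ
  column v = ∑ (suc b) (λ i → indicator (reachᵇ (+ x) (+ y) (+ (a +ℕ i)) (+ v)))

δ≡Γ-row : ∀ a b x y → δ a b x ≡ Γ a b y 0 x y
δ≡Γ-row a b x y = begin
  δ a b x                                        ≡⟨ δ≡σ-row a b x ⟩
  σ (b +ℕ 1) 1 (+ x - + a)                       ≡⟨ cong (σ (b +ℕ 1) 1) (cancel (+ x) (+ y) (+ a)) ⟨
  σ (b +ℕ 1) 1 (((+ x) + (+ y)) - (+ a) - (+ y)) ≡⟨ Γ-above a b y 0 x y ℕ.≤-refl ⟨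
  Γ a b y 0 x y                                  ∎
  where
  cancel : ∀ X Y A → (X + Y) - A - Y ≡ X - A
  cancel = solve-∀

Γ-straddle : ∀ a b c d₁ d₂ x →
  Γ a b c (d₁ +ℕ d₂) x (c +ℕ d₁) +ℕ δ a b x
    ≡ σ (b +ℕ 1) (d₁ +ℕ 1) (+ x - + a) +ℕ σ (b +ℕ 1) (d₂ +ℕ 1) (+ x - + a)
Γ-straddle a b c d₁ d₂ x = begin
  Γ a b c (d₁ +ℕ d₂) x y +ℕ δ a b x
    ≡⟨ cong (Γ a b c (d₁ +ℕ d₂) x y +ℕ_) (δ≡Γ-row a b x y) ⟩
  Γ a b c (d₁ +ℕ d₂) x y +ℕ Γ a b y 0 x y
    ≡⟨ Γ-split a b c d₁ d₂ x y ⟩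
  Γ a b c d₁ x y +ℕ Γ a b y d₂ x y
    ≡⟨ cong₂ _+ℕ_ (Γ-below a b c d₁ x y ℕ.≤-refl) (Γ-above a b y d₂ x y ℕ.≤-refl) ⟩
  σ (b +ℕ 1) (d₁ +ℕ 1) ((+ x) - (+ y) + (+ c) + (+ d₁) - (+ a))
    +ℕ σ (b +ℕ 1) (d₂ +ℕ 1) (((+ x) + (+ y)) - (+ a) - (+ y))
    ≡⟨ cong₂ _+ℕ_ (cong (σ (b +ℕ 1) (d₁ +ℕ 1)) below-y)
                  (cong (σ (b +ℕ 1) (d₂ +ℕ 1)) (cancel (+ x) (+ y) (+ a))) ⟩
  σ (b +ℕ 1) (d₁ +ℕ 1) (+ x - + a) +ℕ σ (b +ℕ 1) (d₂ +ℕ 1) (+ x - + a)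
    ∎
  where
  y : ℕ
  y = c +ℕ d₁
  cancel : ∀ X Y A → (X + Y) - A - Y ≡ X - A
  cancel = solve-∀
  cancel′ : ∀ X C D A → X - (C + D) + C + D - A ≡ X - A
  cancel′ = solve-∀
  below-y : (+ x) - (+ y) + (+ c) + (+ d₁) - (+ a) ≡ + x - + a
  below-y = trans (cong (λ u → (+ x) - u + (+ c) + (+ d₁) - (+ a)) (ℤ.pos-+ c d₁))
                  (cancel′ (+ x) (+ c) (+ d₁) (+ a))

Γ-between : ∀ a b c d x y → c < y → y < c +ℕ d →
  + Γ a b c d x y ≡ ((+ σ (b +ℕ 1) ((y ∸ c) +ℕ 1) ((+ x) - (+ a)))
                     + (+ σ (b +ℕ 1) (((c +ℕ d) ∸ y) +ℕ 1) ((+ x) - (+ a))))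
                    - (+ δ a b x)
Γ-between a b c d x y c<y y<c+d with ℕ.m≤n⇒∃[o]m+o≡n (ℕ.<⇒≤ c<y)
... | d₁ , refl with ℕ.m≤n⇒∃[o]m+o≡n (ℕ.+-cancelˡ-≤ c d₁ d (ℕ.<⇒≤ y<c+d))
...   | d₂ , refl
  rewrite ℕ.m+n∸m≡n c d₁ | ℕ.[m+n]∸[m+o]≡n∸o c (d₁ +ℕ d₂) d₁ | ℕ.m+n∸m≡n d₁ d₂
  = m+n≡o+p⇒+m≡[+o++p]-+n _ (δ a b x) (σ (b +ℕ 1) (d₁ +ℕ 1) (+ x - + a)) _ (Γ-straddle a b c d₁ d₂ x)

lemma2 : (a b c d x y : ℕ) → y ≤ x →
    ((y ≤ c → Γ a b c d x y ≡ σ (b +ℕ 1) (d +ℕ 1) (((+ x) + (+ y)) - (+ a) - (+ c)))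
    × (c < y → y < c +ℕ d →
         + Γ a b c d x y ≡ ((+ σ (b +ℕ 1) ((y ∸ c) +ℕ 1) ((+ x) - (+ a)))
                            + (+ σ (b +ℕ 1) (((c +ℕ d) ∸ y) +ℕ 1) ((+ x) - (+ a))))
                           - (+ δ a b x))
    × (c +ℕ d ≤ y → Γ a b c d x y ≡ σ (b +ℕ 1) (d +ℕ 1) ((+ x) - (+ y) + (+ c) + (+ d) - (+ a))))
lemma2 a b c d x y _ = Γ-above a b c d x y , Γ-between a b c d x y , Γ-below a b c d x y
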